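{- Let $\mathcal{W}=(\mathcal{L},f)$ be a weighted lattice and let $H$ be a coatom of $\mathcal{L}$. Then \[ \mathbb{P}(\mathcal{W};z) = \mathbb{P}(\mathcal{W}|_H;z)\bigl(\mathbb{P}(\mathcal{W}/H;z)+1\bigr)- \sum_{b \text{ atom of } \mathcal{L},\ b \nleq H} \mathbb{P}(\mathcal{W}/b;z). \]
   Context: $\mathcal{L}$ is a finite modular complemented lattice with order $\le$, join $\vee$, meet $\wedge$, least element $\mathbf{0}$ and greatest element $\mathbf{1}$. An atom is an element covering $\mathbf{0}$; a coatom is an element covered by $\mathbf{1}$. $\mu$ denotes the Möbius function of $\mathcal{L}$. A weighted lattice is a pair $\mathcal{W}=(\mathcal{L},f)$ with $f:\mathcal{L}\to\mathbb{N}_0$, $f(\mathbf{0})=0$ and $f(A)\le f(B)$ whenever $A\le B$. For $X\le Y$ in $\mathcal{L}$, $\mathcal{W}([X,Y])$ is the weighted lattice on the interval $[X,Y]$ with weight $f_{[X,Y]}(T)=f(T)-f(X)$; write $\mathcal{W}|_Y=\mathcal{W}([\mathbf{0},Y])$ and $\mathcal{W}/X=\mathcal{W}([X,\mathbf{1}])$. The characteristic polynomial is $\mathbb{P}(\mathcal{W}([X,Y]);z)=\sum_{A\in[X,Y]}\mu(X,A)z^{f(Y)-f(A)}\in\mathbb{Z}[z]$; in particular $\mathbb{P}(\mathcal{W};z)=\sum_{A\in\mathcal{L}}\mu(\mathbf{0},A)z^{f(\mathbf{1})-f(A)}$. -}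

module Defs where

open import Level using (0ℓ)
open import Data.Nat as ℕ using (ℕ; zero; suc; _∸_)
import Data.Nat.Properties as ℕP
open import Data.Integer as ℤ using (ℤ; +_; -_)
open import Data.Bool using (Bool; true; false; if_then_else_; _∧_; not)
open import Data.List using (List; []; _∷_; map; length; upTo; foldr)
open import Data.List.Membership.Propositional using (_∈_)
open import Data.List.Relation.Unary.Unique.Propositional using (Unique)
open import Data.List.Relation.Unary.Any as Any using (Any)
open import Data.Product using (Σ; ∃; _×_; _,_; proj₁; proj₂)
open import Data.Empty using (⊥)
open import Relation.Nullary using (¬_; Dec; yes; no; does)
open import Relation.Nullary.Decidable using (_×-dec_; ¬?)
open import Relation.Binary.Core using (Rel)
open import Relation.Binary.Definitions using (Decidable; DecidableEquality)
open import Relation.Binary.PropositionalEquality using (_≡_; _≢_)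
open import Relation.Binary.Lattice.Structures using (IsBoundedLattice)
open import Algebra.Core using (Op₂)

record FMCLattice : Set₁ where
  field
    Carrier          : Set
    _≤_              : Rel Carrier 0ℓ
    _∨_              : Op₂ Carrier
    _∧L_             : Op₂ Carrier
    𝟏                : Carrier
    𝟎                : Carrier
    isBoundedLattice : IsBoundedLattice _≡_ _≤_ _∨_ _∧L_ 𝟏 𝟎
    _≤?_             : Decidable _≤_
    _≟_              : DecidableEquality Carrier
    elems            : List Carrier
    elems-complete   : ∀ x → x ∈ elems
    elems-unique     : Unique elems
    modular          : ∀ x y z → x ≤ z → (x ∨ (y ∧L z)) ≡ ((x ∨ y) ∧L z)
    complemented     : ∀ x → ∃ λ y → (x ∨ y ≡ 𝟏) × (x ∧L y ≡ 𝟎)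

  infix 4 _≤_ _<_

  _<_ : Rel Carrier 0ℓ
  x < y = x ≤ y × x ≢ y

  _⋖_ : Rel Carrier 0ℓ
  x ⋖ y = x < y × ¬ (∃ λ z → x < z × z < y)

  IsAtom : Carrier → Set
  IsAtom b = 𝟎 ⋖ b

  IsCoatom : Carrier → Set
  IsCoatom h = h ⋖ 𝟏

  _<?_ : Decidable _<_
  x <? y = (x ≤? y) ×-dec ¬? (x ≟ y)

  _⋖?_ : Decidable _⋖_
  x ⋖? y with x <? y | Any.any? (λ z → (x <? z) ×-dec (z <? y)) elems
  ... | no ¬p | _ = no (λ c → ¬p (proj₁ c))
  ... | yes p | yes a = no (λ c → proj₂ c (Data.List.Relation.Unary.Any.satisfied a))
    where import Data.List.Relation.Unary.Any
  ... | yes p | no ¬a = yes (p , λ { (z , q) → ¬a (Any.map (λ { _≡_.refl → q }) (elems-complete z)) })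

  -- Möbius function, by the usual recursion
  --   μ(x,x) = 1,  μ(x,y) = - Σ_{x ≤ z < y} μ(x,z) for x < y,  0 otherwise,
  -- run with fuel = |L| (every chain has fewer than |L| steps).

  sumℤ : List ℤ → ℤ
  sumℤ = foldr ℤ._+_ (+ 0)

  μ-fuel : ℕ → Carrier → Carrier → ℤ
  μ-fuel n x y with x ≟ y
  ... | yes _ = + 1
  μ-fuel zero    x y | no _ = + 0
  μ-fuel (suc n) x y | no _ =
    if does (x ≤? y)
    then - sumℤ (map (λ z → if does (x ≤? z) ∧ does (z <? y) then μ-fuel n x z else + 0) elems)
    else + 0

  μ : Carrier → Carrier → ℤ
  μ = μ-fuel (length elems)

-- Polynomials in ℤ[z], as coefficient sequences (coefficient of z^k);
-- all polynomials below have finite support.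

Poly : Set
Poly = ℕ → ℤ

zpow : ℕ → Poly
zpow n k = if does (k ℕ.≟ n) then + 1 else + 0

_·ₚ_ : ℤ → Poly → Poly
(c ·ₚ p) k = c ℤ.* p k

_+ₚ_ : Poly → Poly → Poly
(p +ₚ q) k = p k ℤ.+ q k

_-ₚ_ : Poly → Poly → Poly
(p -ₚ q) k = p k ℤ.- q k

_*ₚ_ : Poly → Poly → Poly
(p *ₚ q) k = foldr ℤ._+_ (+ 0) (map (λ i → p i ℤ.* q (k ∸ i)) (upTo (suc k)))

1ₚ : Poly
1ₚ = zpow 0

0ₚ : Poly
0ₚ _ = + 0

sumₚ : List Poly → Poly
sumₚ = foldr _+ₚ_ 0ₚ

record WeightedLattice : Set₁ where
  field
    L     : FMCLattice
  open FMCLattice L public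
  field
    f     : Carrier → ℕ
    f-𝟎   : f 𝟎 ≡ 0
    f-mon : ∀ {A B} → A ≤ B → f A ℕ.≤ f B

  -- characteristic polynomial of the weighted interval W([X,Y]),
  -- with weight f_[X,Y](T) = f(T) - f(X):
  --   P(W([X,Y]); z) = Σ_{A ∈ [X,Y]} μ(X,A) z^(f_[X,Y](Y) - f_[X,Y](A))
  χ[_,_] : Carrier → Carrier → Poly
  χ[ X , Y ] = sumₚ (map term elems)
    where
      fXY : Carrier → ℕ
      fXY T = f T ∸ f X
      term : Carrier → Poly
      term A = if does (X ≤? A) ∧ does (A ≤? Y)
               then μ X A ·ₚ zpow (fXY Y ∸ fXY A)
               else 0ₚ

  χ : Poly
  χ = χ[ 𝟎 , 𝟏 ]

  χ|_ : Carrier → Poly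
  χ| Y = χ[ 𝟎 , Y ]

  χ/_ : Carrier → Poly
  χ/ X = χ[ X , 𝟏 ]

  atomSumNotBelow : Carrier → Poly
  atomSumNotBelow H =
    sumₚ (map (λ b → if does (IsAtom? b) ∧ not (does (b ≤? H)) then χ/ b else 0ₚ) elems)
    where
      IsAtom? : (b : Carrier) → Dec (IsAtom b)
      IsAtom? b = 𝟎 ⋖? b

-- Write P(W;z) = Σ_A μ(𝟎,A) z^(f 𝟏 - f A) and split the sum according to A ≤ H or A ≰ H.
-- The part A ≤ H is P(W|_H;z) z^(f 𝟏 - f H), and P(W/H;z) + 1 = z^(f 𝟏 - f H) because the
-- interval [H,𝟏] is {H,𝟏}. For A ≰ H there is a Weisner-type identity
--   μ(𝟎,A) = - Σ_{b atom, b ≰ H, b ≤ A} μ(b,A):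
-- summed over all z ≤ A with z ≰ H, the left side gives -[A ∧ H = 𝟎] and the right side
-- -[A is an atom], which agree by modularity; well-founded induction on A then gives the
-- identity termwise. Exchanging the sums over A and b turns the part A ≰ H into
-- - Σ_b P(W/b;z).
module Submission where

open import Defs
open import Level using (0ℓ)
open import Data.Nat as ℕ using (ℕ; zero; suc; _∸_; z≤n; s≤s)
import Data.Nat.Properties as ℕP
import Data.Nat.Induction as ℕI
open import Data.Integer using (ℤ; +_; -_; _+_; _*_)
import Data.Integer.Properties as ℤP
open import Algebra.Properties.AbelianGroup ℤP.+-0-abelianGroup using (inverseˡ-unique)
open import Data.Integer.Tactic.RingSolver using (solve-∀)
open import Data.Bool using (Bool; true; false; if_then_else_; _∧_; not)
open import Data.Bool.Properties using (¬-not)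
open import Data.List using (List; []; _∷_; map; foldr; length; upTo)
open import Data.List.Membership.Propositional using (_∈_)
open import Data.List.Membership.Propositional.Properties using (∈-upTo⁺; ∈-upTo⁻)
open import Data.List.Relation.Unary.Any using (here; there)
import Data.List.Relation.Unary.All as All
open import Data.List.Relation.Unary.AllPairs using (_∷_)
open import Data.List.Relation.Unary.Unique.Propositional using (Unique)
open import Data.List.Relation.Unary.Unique.Propositional.Properties using (upTo⁺)
open import Data.Product using (_×_; _,_; proj₁; proj₂)
open import Data.Empty using (⊥-elim)
open import Function using (_on_)
open import Induction.WellFounded using (WellFounded)
import Induction.WellFounded as WF
import Relation.Binary.Construct.On as On
open import Relation.Binary.Lattice.Bundles using (BoundedLattice)
open import Relation.Binary.Lattice.Structures using (IsBoundedLattice)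
open import Relation.Binary.Structures using (IsPartialOrder)
open import Relation.Binary.PropositionalEquality
open import Relation.Nullary using (¬_; Dec; yes; no; does)
open import Relation.Nullary.Decidable using (dec-true; dec-false)

module _ {A : Set} where

  -- Definitionally the sum sumℤ (map g xs) used by μ-fuel in Defs.
  ∑ : List A → (A → ℤ) → ℤ
  ∑ xs g = foldr _+_ (+ 0) (map g xs)

  ∑-cong : ∀ xs {g h : A → ℤ} → (∀ x → g x ≡ h x) → ∑ xs g ≡ ∑ xs h
  ∑-cong []       eq = refl
  ∑-cong (x ∷ xs) eq = cong₂ _+_ (eq x) (∑-cong xs eq)

  ∑-zero-on : ∀ xs {g : A → ℤ} → (∀ x → x ∈ xs → g x ≡ + 0) → ∑ xs g ≡ + 0
  ∑-zero-on []       eq = refl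
  ∑-zero-on (x ∷ xs) eq = cong₂ _+_ (eq x (here refl)) (∑-zero-on xs (λ y m → eq y (there m)))

  ∑-zero : ∀ xs {g : A → ℤ} → (∀ x → g x ≡ + 0) → ∑ xs g ≡ + 0
  ∑-zero xs eq = ∑-zero-on xs (λ x _ → eq x)

  ∑-distrib-+ : ∀ xs (g h : A → ℤ) → ∑ xs (λ x → g x + h x) ≡ ∑ xs g + ∑ xs h
  ∑-distrib-+ []       g h = refl
  ∑-distrib-+ (x ∷ xs) g h =
    trans (cong (_+_ (g x + h x)) (∑-distrib-+ xs g h)) (interchange (g x) (h x) (∑ xs g) (∑ xs h))
    where
      interchange : ∀ a b c d → (a + b) + (c + d) ≡ (a + c) + (b + d)
      interchange = solve-∀

  ∑-distribʳ-* : ∀ xs (g : A → ℤ) c → ∑ xs (λ x → g x * c) ≡ ∑ xs g * c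
  ∑-distribʳ-* []       g c = sym (ℤP.*-zeroˡ c)
  ∑-distribʳ-* (x ∷ xs) g c =
    trans (cong (_+_ (g x * c)) (∑-distribʳ-* xs g c)) (sym (ℤP.*-distribʳ-+ c (g x) (∑ xs g)))

  ∑-neg : ∀ xs (g : A → ℤ) → ∑ xs (λ x → - g x) ≡ - ∑ xs g
  ∑-neg []       g = refl
  ∑-neg (x ∷ xs) g = trans (cong (_+_ (- g x)) (∑-neg xs g)) (sym (ℤP.neg-distrib-+ (g x) (∑ xs g)))

  ∑-single : ∀ xs a (g : A → ℤ) → Unique xs → a ∈ xs →
             (∀ x → x ∈ xs → x ≢ a → g x ≡ + 0) → ∑ xs g ≡ g a
  ∑-single (y ∷ ys) a g (y∉ys ∷ _) (here refl) off =
    trans (cong (_+_ (g y)) (∑-zero-on ys (λ x m → off x (there m) (λ x≡y → All.lookup y∉ys m (sym x≡y)))))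
          (ℤP.+-identityʳ (g y))
  ∑-single (y ∷ ys) a g (y∉ys ∷ u) (there m) off =
    trans (cong₂ _+_ (off y (here refl) (All.lookup y∉ys m))
                     (∑-single ys a g u m (λ x m' → off x (there m'))))
          (ℤP.+-identityˡ (g a))

∑-comm : ∀ {A B : Set} (xs : List A) (ys : List B) (F : A → B → ℤ) →
         ∑ xs (λ x → ∑ ys (F x)) ≡ ∑ ys (λ y → ∑ xs (λ x → F x y))
∑-comm []       ys F = sym (∑-zero ys (λ _ → refl))
∑-comm (x ∷ xs) ys F =
  trans (cong (_+_ (∑ ys (F x))) (∑-comm xs ys F)) (sym (∑-distrib-+ ys (F x) (λ y → ∑ xs (λ x' → F x' y))))

infixr 8 [_]·_

[_]·_ : Bool → ℤ → ℤ
[ b ]· v = if b then v else + 0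

[]·-cong : ∀ b {u v} → (b ≡ true → u ≡ v) → [ b ]· u ≡ [ b ]· v
[]·-cong true  eq = eq refl
[]·-cong false eq = refl

[]·-zero : ∀ b {v} → (b ≡ true → v ≡ + 0) → [ b ]· v ≡ + 0
[]·-zero true  eq = eq refl
[]·-zero false eq = refl

[true]· : ∀ {b v} → b ≡ true → [ b ]· v ≡ v
[true]· refl = refl

[false]· : ∀ {b v} → b ≡ false → [ b ]· v ≡ + 0
[false]· refl = refl

[]·-distrib-+ : ∀ b u v → [ b ]· (u + v) ≡ [ b ]· u + [ b ]· v
[]·-distrib-+ true  u v = refl
[]·-distrib-+ false u v = refl

[]·-distribʳ-* : ∀ b u v → ([ b ]· u) * v ≡ [ b ]· (u * v)
[]·-distribʳ-* true  u v = refl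
[]·-distribʳ-* false u v = refl

[]·-∑ : ∀ {A : Set} b xs (g : A → ℤ) → [ b ]· ∑ xs g ≡ ∑ xs (λ x → [ b ]· g x)
[]·-∑ true  xs g = refl
[]·-∑ false xs g = sym (∑-zero xs (λ _ → refl))

does-true⇒ : ∀ {P : Set} (d : Dec P) → does d ≡ true → P
does-true⇒ (yes p) _ = p

does∧¬does⇒ : ∀ {P Q : Set} (p : Dec P) (q : Dec Q) → does p ∧ not (does q) ≡ true → P × ¬ Q
does∧¬does⇒ (yes p) (no ¬q) _ = p , ¬q

sumₚ-apply : ∀ {A : Set} (t : A → Poly) xs k → sumₚ (map t xs) k ≡ ∑ xs (λ x → t x k)
sumₚ-apply t []       k = refl
sumₚ-apply t (x ∷ xs) k = cong (_+_ (t x k)) (sumₚ-apply t xs k)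

*ₚ-congʳ : ∀ p {q q′ : Poly} → (∀ j → q j ≡ q′ j) → ∀ k → (p *ₚ q) k ≡ (p *ₚ q′) k
*ₚ-congʳ p eq k = ∑-cong (upTo (suc k)) (λ i → cong (p i *_) (eq (k ∸ i)))

zpow-≢ : ∀ {n k} → k ≢ n → zpow n k ≡ + 0
zpow-≢ {n} {k} k≢n = [false]· (dec-false (k ℕ.≟ n) k≢n)

zpow-refl : ∀ n → zpow n n ≡ + 1
zpow-refl n = [true]· (dec-true (n ℕ.≟ n) refl)

*ₚ-zpow-≤ : ∀ p {d k} → d ℕ.≤ k → (p *ₚ zpow d) k ≡ p (k ∸ d)
*ₚ-zpow-≤ p {d} {k} d≤k = begin
  (p *ₚ zpow d) k                    ≡⟨ ∑-single (upTo (suc k)) (k ∸ d) _ (upTo⁺ (suc k))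
                                          (∈-upTo⁺ (s≤s (ℕP.m∸n≤m k d))) off ⟩
  p (k ∸ d) * zpow d (k ∸ (k ∸ d))   ≡⟨ cong (λ e → p (k ∸ d) * zpow d e) (ℕP.m∸[m∸n]≡n d≤k) ⟩
  p (k ∸ d) * zpow d d               ≡⟨ cong (p (k ∸ d) *_) (zpow-refl d) ⟩
  p (k ∸ d) * + 1                    ≡⟨ ℤP.*-identityʳ (p (k ∸ d)) ⟩
  p (k ∸ d)                          ∎
  where
    open ≡-Reasoning
    off : ∀ i → i ∈ upTo (suc k) → i ≢ k ∸ d → p i * zpow d (k ∸ i) ≡ + 0
    off i i∈ i≢ = trans (cong (p i *_) (zpow-≢ {d} {k ∸ i} λ k∸i≡d →
                    i≢ (trans (sym (ℕP.m∸[m∸n]≡n (ℕP.≤-pred (∈-upTo⁻ i∈)))) (cong (k ∸_) k∸i≡d))))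
                  (ℤP.*-zeroʳ (p i))

*ₚ-zpow-≰ : ∀ p {d k} → ¬ d ℕ.≤ k → (p *ₚ zpow d) k ≡ + 0
*ₚ-zpow-≰ p {d} {k} d≰k = ∑-zero (upTo (suc k)) λ i →
  trans (cong (p i *_) (zpow-≢ {d} {k ∸ i} λ k∸i≡d → d≰k (subst (ℕ._≤ k) k∸i≡d (ℕP.m∸n≤m k i)))) (ℤP.*-zeroʳ (p i))

zpow-+-≤ : ∀ {d k} e → d ℕ.≤ k → zpow (d ℕ.+ e) k ≡ zpow e (k ∸ d)
zpow-+-≤ {d} {k} e d≤k with k ℕ.≟ d ℕ.+ e
... | yes refl = trans (zpow-refl (d ℕ.+ e)) (sym (trans (cong (zpow e) (ℕP.m+n∸m≡n d e)) (zpow-refl e)))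
... | no  k≢   = trans (zpow-≢ k≢) (sym (zpow-≢ λ k∸d≡e →
                   k≢ (trans (sym (ℕP.m+[n∸m]≡n d≤k)) (cong (d ℕ.+_) k∸d≡e))))

zpow-+-≰ : ∀ {d k} e → ¬ d ℕ.≤ k → zpow (d ℕ.+ e) k ≡ + 0
zpow-+-≰ {d} e d≰k = zpow-≢ λ k≡ → d≰k (subst (d ℕ.≤_) (sym k≡) (ℕP.m≤m+n d e))

[m∸o]∸[n∸o]≡m∸n : ∀ m n o → o ℕ.≤ n → (m ∸ o) ∸ (n ∸ o) ≡ m ∸ n
[m∸o]∸[n∸o]≡m∸n m n o o≤n = trans (ℕP.∸-+-assoc m o (n ∸ o)) (cong (m ∸_) (ℕP.m+[n∸m]≡n o≤n))

[m∸n]+[n∸o]≡m∸o : ∀ {m n o} → o ℕ.≤ n → n ℕ.≤ m → (m ∸ n) ℕ.+ (n ∸ o) ≡ m ∸ o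
[m∸n]+[n∸o]≡m∸o {m} {n} {o} o≤n n≤m =
  trans (sym (ℕP.+-∸-assoc (m ∸ n) o≤n)) (cong (_∸ o) (ℕP.m∸n+n≡m n≤m))

ifₚ-apply : ∀ b (p : Poly) k → (if b then p else 0ₚ) k ≡ [ b ]· p k
ifₚ-apply true  p k = refl
ifₚ-apply false p k = refl

*ₚ-zpow-shift : ∀ {A : Set} p d xs (c : A → ℤ) (e : A → ℕ) →
  (∀ j → p j ≡ ∑ xs (λ x → c x * zpow (e x) j)) →
  ∀ k → (p *ₚ zpow d) k ≡ ∑ xs (λ x → c x * zpow (d ℕ.+ e x) k)
*ₚ-zpow-shift p d xs c e p≡ k with d ℕ.≤? k
... | yes d≤k = trans (*ₚ-zpow-≤ p d≤k)
                  (trans (p≡ (k ∸ d)) (∑-cong xs (λ x → cong (c x *_) (sym (zpow-+-≤ (e x) d≤k)))))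
... | no  d≰k = trans (*ₚ-zpow-≰ p d≰k)
                  (sym (∑-zero xs (λ x → trans (cong (c x *_) (zpow-+-≰ (e x) d≰k)) (ℤP.*-zeroʳ (c x)))))

module _ {A : Set} where

  count : (A → Bool) → List A → ℕ
  count p []       = 0
  count p (x ∷ xs) = if p x then suc (count p xs) else count p xs

  count-mono : ∀ (p q : A → Bool) xs → (∀ x → p x ≡ true → q x ≡ true) → count p xs ℕ.≤ count q xs
  count-mono p q []       p⇒q = z≤n
  count-mono p q (x ∷ xs) p⇒q with p x in px | q x in qx
  ... | true  | true  = s≤s (count-mono p q xs p⇒q)
  ... | true  | false with () ← trans (sym qx) (p⇒q x px)
  ... | false | true  = ℕP.m≤n⇒m≤1+n (count-mono p q xs p⇒q)
  ... | false | false = count-mono p q xs p⇒q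

  count-mono-< : ∀ (p q : A → Bool) xs a → (∀ x → p x ≡ true → q x ≡ true) →
                 a ∈ xs → p a ≡ false → q a ≡ true → count p xs ℕ.< count q xs
  count-mono-< p q (x ∷ xs) a p⇒q (here refl) pa qa rewrite pa | qa = s≤s (count-mono p q xs p⇒q)
  count-mono-< p q (x ∷ xs) a p⇒q (there a∈) pa qa with p x in px | q x in qx
  ... | true  | true  = s≤s (count-mono-< p q xs a p⇒q a∈ pa qa)
  ... | true  | false with () ← trans (sym qx) (p⇒q x px)
  ... | false | true  = ℕP.m≤n⇒m≤1+n (count-mono-< p q xs a p⇒q a∈ pa qa)
  ... | false | false = count-mono-< p q xs a p⇒q a∈ pa qa

  count-true : ∀ xs → count (λ _ → true) xs ≡ length xs
  count-true []       = refl
  count-true (x ∷ xs) = cong suc (count-true xs)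

module FMCLatticeProperties (L : FMCLattice) where

  open FMCLattice L

  open IsBoundedLattice isBoundedLattice public
    using (x≤x∨y; y≤x∨y; x∧y≤x; x∧y≤y; ∧-greatest)
    renaming (maximum to x≤𝟏; minimum to 𝟎≤x)
  open IsPartialOrder (IsBoundedLattice.isPartialOrder isBoundedLattice) public
    using () renaming (refl to ≤-refl; trans to ≤-trans; antisym to ≤-antisym)

  private
    boundedLattice : BoundedLattice 0ℓ 0ℓ 0ℓ
    boundedLattice = record { isBoundedLattice = isBoundedLattice }

  open import Relation.Binary.Lattice.Properties.MeetSemilattice
    (BoundedLattice.meetSemilattice boundedLattice) public
    using (∧-comm; y≤x⇒x∧y≈y)
  open import Relation.Binary.Lattice.Properties.BoundedJoinSemilattice
    (BoundedLattice.boundedJoinSemilattice boundedLattice) public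
    using () renaming (identityʳ to ∨-identityʳ)

  <-irrefl : ∀ {x} → ¬ x < x
  <-irrefl (_ , x≢x) = x≢x refl

  <-trans : ∀ {x y z} → x < y → y < z → x < z
  <-trans (x≤y , x≢y) (y≤z , y≢z) = ≤-trans x≤y y≤z , λ { refl → x≢y (≤-antisym x≤y y≤z) }

  rank : Carrier → ℕ
  rank y = count (λ z → does (z <? y)) elems

  rank-mono-< : ∀ {x y} → x < y → rank x ℕ.< rank y
  rank-mono-< {x} {y} x<y =
    count-mono-< (λ z → does (z <? x)) (λ z → does (z <? y)) elems x
      (λ z z<x → dec-true (z <? y) (<-trans (does-true⇒ (z <? x) z<x) x<y))
      (elems-complete x) (dec-false (x <? x) <-irrefl) (dec-true (x <? y) x<y)

  rank<length : ∀ y → rank y ℕ.< length elems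
  rank<length y = subst (rank y ℕ.<_) (count-true elems)
    (count-mono-< _ (λ _ → true) elems y (λ _ _ → refl) (elems-complete y) (dec-false (y <? y) <-irrefl) refl)

  <-wellFounded : WellFounded _<_
  <-wellFounded = WF.Subrelation.wellFounded {_<₂_ = ℕ._<_ on rank} rank-mono-< (On.wellFounded rank ℕI.<-wellFounded)

  ∑ᴸ : (Carrier → ℤ) → ℤ
  ∑ᴸ = ∑ elems

  ∑ᴸ-single : ∀ a (g : Carrier → ℤ) → (∀ x → x ≢ a → g x ≡ + 0) → ∑ᴸ g ≡ g a
  ∑ᴸ-single a g off = ∑-single elems a g elems-unique (elems-complete a) (λ x _ → off x)

  ∑ᴸ-indicator : ∀ a v → ∑ᴸ (λ z → [ does (z ≟ a) ]· v) ≡ v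
  ∑ᴸ-indicator a v = trans (∑ᴸ-single a _ (λ z z≢a → [false]· (dec-false (z ≟ a) z≢a)))
                           ([true]· (dec-true (a ≟ a) refl))

  μ-fuel-suc : ∀ n x y → rank y ℕ.≤ n → μ-fuel n x y ≡ μ-fuel (suc n) x y
  μ-fuel-suc n x y r with x ≟ y
  ... | yes _ = refl
  μ-fuel-suc zero x y r | no x≢y with x ≤? y
  ... | yes x≤y = ⊥-elim (ℕP.n≮0 (ℕP.<-≤-trans (rank-mono-< (x≤y , x≢y)) r))
  ... | no  _   = refl
  μ-fuel-suc (suc n) x y r | no _ with x ≤? y
  ... | yes _ = cong -_ (∑-cong elems step)
    where
      step : ∀ z → [ does (x ≤? z) ∧ does (z <? y) ]· μ-fuel n x z
                 ≡ [ does (x ≤? z) ∧ does (z <? y) ]· μ-fuel (suc n) x z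
      -- does (z <? y) normalises to does (z ≤? y) ∧ not (does (z ≟ y)), so we split on those.
      step z with x ≤? z | z ≤? y | z ≟ y
      ... | yes _ | yes z≤y | no z≢y = μ-fuel-suc n x z (ℕP.≤-pred (ℕP.<-≤-trans (rank-mono-< (z≤y , z≢y)) r))
      ... | yes _ | yes _   | yes _  = refl
      ... | yes _ | no  _   | _      = refl
      ... | no  _ | _       | _      = refl
  ... | no  _ = refl

  μ-fuel-unfold : ∀ m {x y} → x < y →
    μ-fuel (suc m) x y ≡ - ∑ᴸ (λ z → [ does (x ≤? z) ∧ does (z <? y) ]· μ-fuel m x z)
  μ-fuel-unfold m {x} {y} (x≤y , x≢y) with x ≟ y
  ... | yes x≡y = ⊥-elim (x≢y x≡y)
  ... | no  _ with x ≤? y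
  ...   | yes _   = refl
  ...   | no  x≰y = ⊥-elim (x≰y x≤y)

  μ-unfold : ∀ {x y} → x < y → μ x y ≡ - ∑ᴸ (λ z → [ does (x ≤? z) ∧ does (z <? y) ]· μ x z)
  μ-unfold {x} {y} x<y = go (length elems) (rank<length y)
    where
      go : ∀ N → rank y ℕ.< N → μ-fuel N x y ≡ - ∑ᴸ (λ z → [ does (x ≤? z) ∧ does (z <? y) ]· μ-fuel N x z)
      go (suc n) (s≤s r) = trans (μ-fuel-suc (suc n) x y (ℕP.m≤n⇒m≤1+n r)) (μ-fuel-unfold (suc n) x<y)

  μ-refl : ∀ x → μ x x ≡ + 1
  μ-refl x with x ≟ x
  ... | yes _   = refl
  ... | no  x≢x = ⊥-elim (x≢x refl)

  ∑-μ-interval : ∀ x y → ∑ᴸ (λ z → [ does (x ≤? z) ∧ does (z ≤? y) ]· μ x z) ≡ [ does (x ≟ y) ]· + 1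
  ∑-μ-interval x y with x ≟ y
  ... | yes refl = trans (∑ᴸ-single x _ off) at-x
    where
      off : ∀ z → z ≢ x → [ does (x ≤? z) ∧ does (z ≤? x) ]· μ x z ≡ + 0
      off z z≢x with x ≤? z | z ≤? x
      ... | yes x≤z | yes z≤x = ⊥-elim (z≢x (≤-antisym z≤x x≤z))
      ... | yes _   | no  _   = refl
      ... | no  _   | _       = refl
      at-x : [ does (x ≤? x) ∧ does (x ≤? x) ]· μ x x ≡ + 1
      at-x with x ≤? x
      ... | yes _   = μ-refl x
      ... | no  x≰x = ⊥-elim (x≰x ≤-refl)
  ... | no x≢y with x ≤? y
  ...   | no  x≰y = ∑-zero elems outside
    where
      outside : ∀ z → [ does (x ≤? z) ∧ does (z ≤? y) ]· μ x z ≡ + 0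
      outside z with x ≤? z | z ≤? y
      ... | yes x≤z | yes z≤y = ⊥-elim (x≰y (≤-trans x≤z z≤y))
      ... | yes _   | no  _   = refl
      ... | no  _   | _       = refl
  ...   | yes x≤y = begin
    ∑ᴸ (λ z → [ does (x ≤? z) ∧ does (z ≤? y) ]· μ x z)
      ≡⟨ ∑-cong elems split ⟩
    ∑ᴸ (λ z → [ does (x ≤? z) ∧ does (z <? y) ]· μ x z + [ does (z ≟ y) ]· μ x y)
      ≡⟨ ∑-distrib-+ elems _ _ ⟩
    ∑ᴸ (λ z → [ does (x ≤? z) ∧ does (z <? y) ]· μ x z) + ∑ᴸ (λ z → [ does (z ≟ y) ]· μ x y)
      ≡⟨ cong₂ _+_ below-y (∑ᴸ-indicator y (μ x y)) ⟩
    - μ x y + μ x y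
      ≡⟨ ℤP.+-inverseˡ (μ x y) ⟩
    + 0 ∎
    where
      open ≡-Reasoning
      below-y : ∑ᴸ (λ z → [ does (x ≤? z) ∧ does (z <? y) ]· μ x z) ≡ - μ x y
      below-y = trans (sym (ℤP.neg-involutive _)) (cong -_ (sym (μ-unfold (x≤y , x≢y))))
      split : ∀ z → [ does (x ≤? z) ∧ does (z ≤? y) ]· μ x z
                  ≡ [ does (x ≤? z) ∧ does (z <? y) ]· μ x z + [ does (z ≟ y) ]· μ x y
      split z with x ≤? z | z ≤? y | z ≟ y
      ... | yes _   | yes _   | yes refl = sym (ℤP.+-identityˡ (μ x z))
      ... | yes _   | yes _   | no  _    = sym (ℤP.+-identityʳ (μ x z))
      ... | yes _   | no  y≰y | yes refl = ⊥-elim (y≰y ≤-refl)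
      ... | yes _   | no  _   | no  _    = refl
      ... | no  x≰y | _       | yes refl = ⊥-elim (x≰y x≤y)
      ... | no  _   | _       | no  _    = refl

  ∑-⋖-interval : ∀ {x y} → x ⋖ y → (g : Carrier → ℤ) →
    ∑ᴸ (λ z → [ does (x ≤? z) ∧ does (z ≤? y) ]· g z) ≡ g x + g y
  ∑-⋖-interval {x} {y} ((x≤y , x≢y) , nothing-between) g = begin
    ∑ᴸ (λ z → [ does (x ≤? z) ∧ does (z ≤? y) ]· g z)
      ≡⟨ ∑-cong elems split ⟩
    ∑ᴸ (λ z → [ does (z ≟ x) ]· g x + [ does (z ≟ y) ]· g y)
      ≡⟨ ∑-distrib-+ elems _ _ ⟩
    ∑ᴸ (λ z → [ does (z ≟ x) ]· g x) + ∑ᴸ (λ z → [ does (z ≟ y) ]· g y)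
      ≡⟨ cong₂ _+_ (∑ᴸ-indicator x (g x)) (∑ᴸ-indicator y (g y)) ⟩
    g x + g y ∎
    where
      open ≡-Reasoning
      split : ∀ z → [ does (x ≤? z) ∧ does (z ≤? y) ]· g z ≡ [ does (z ≟ x) ]· g x + [ does (z ≟ y) ]· g y
      split z with z ≟ x | z ≟ y | x ≤? z | z ≤? y
      ... | yes refl | yes refl | _       | _       = ⊥-elim (x≢y refl)
      ... | yes refl | no  _    | yes _   | yes _   = sym (ℤP.+-identityʳ (g x))
      ... | yes refl | no  _    | no  x≰x | _       = ⊥-elim (x≰x ≤-refl)
      ... | yes refl | no  _    | yes _   | no  x≰y = ⊥-elim (x≰y x≤y)
      ... | no  _    | yes refl | yes _   | yes _   = sym (ℤP.+-identityˡ (g y))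
      ... | no  _    | yes refl | no  x≰y | _       = ⊥-elim (x≰y x≤y)
      ... | no  _    | yes refl | yes _   | no  y≰y = ⊥-elim (y≰y ≤-refl)
      ... | no  z≢x  | no  z≢y  | yes x≤z | yes z≤y =
        ⊥-elim (nothing-between (z , (x≤z , λ x≡z → z≢x (sym x≡z)) , (z≤y , z≢y)))
      ... | no  _    | no  _    | yes _   | no  _   = refl
      ... | no  _    | no  _    | no  _   | _       = refl

  μ-⋖ : ∀ {x y} → x ⋖ y → μ x y ≡ - + 1
  μ-⋖ {x} {y} x⋖y@((_ , x≢y) , _) = begin
    μ x y                             ≡⟨ cancelˡ (μ x x) (μ x y) ⟩
    (μ x x + μ x y) + - μ x x         ≡⟨ cong₂ (λ s t → s + - t) (sym (∑-⋖-interval x⋖y (μ x))) (μ-refl x) ⟩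
    ∑ᴸ (λ z → [ does (x ≤? z) ∧ does (z ≤? y) ]· μ x z) + - + 1
                                      ≡⟨ cong (λ s → s + - + 1) (∑-μ-interval x y) ⟩
    [ does (x ≟ y) ]· + 1 + - + 1     ≡⟨ cong (λ s → s + - + 1) ([false]· (dec-false (x ≟ y) x≢y)) ⟩
    - + 1                             ∎
    where
      open ≡-Reasoning
      cancelˡ : ∀ a b → b ≡ (a + b) + - a
      cancelˡ = solve-∀

module CoatomProperties (L : FMCLattice) (H : FMCLattice.Carrier L) (H⋖𝟏 : FMCLattice.IsCoatom L H) where

  open FMCLattice L
  open FMCLatticeProperties L

  atom≰H : Carrier → Bool
  atom≰H b = does (𝟎 ⋖? b) ∧ not (does (b ≤? H))

  atom≰H-intro : ∀ {b} → IsAtom b → ¬ b ≤ H → atom≰H b ≡ true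
  atom≰H-intro {b} atom b≰H = cong₂ (λ u v → u ∧ not v) (dec-true (𝟎 ⋖? b) atom) (dec-false (b ≤? H) b≰H)

  atom≰H-elim : ∀ {b} → atom≰H b ≡ true → IsAtom b × ¬ b ≤ H
  atom≰H-elim {b} = does∧¬does⇒ (𝟎 ⋖? b) (b ≤? H)

  μ-atoms : Carrier → ℤ
  μ-atoms A = ∑ᴸ (λ b → [ atom≰H b ]· [ does (b ≤? A) ]· μ b A)

  μ-atoms-≤H : ∀ {A} → A ≤ H → μ-atoms A ≡ + 0
  μ-atoms-≤H {A} A≤H = ∑-zero elems term
    where
      term : ∀ b → [ atom≰H b ]· [ does (b ≤? A) ]· μ b A ≡ + 0
      term b with atom≰H b in e
      ... | false = refl
      ... | true with b ≤? A
      ...   | yes b≤A = ⊥-elim (proj₂ (atom≰H-elim e) (≤-trans b≤A A≤H))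
      ...   | no  _   = refl

  ≰H⇒∨H≡𝟏 : ∀ {y} → ¬ y ≤ H → y ∨ H ≡ 𝟏
  ≰H⇒∨H≡𝟏 {y} y≰H with (y ∨ H) ≟ 𝟏
  ... | yes y∨H≡𝟏 = y∨H≡𝟏
  ... | no  y∨H≢𝟏 = ⊥-elim (proj₂ H⋖𝟏 (y ∨ H , (y≤x∨y y H , H≢y∨H) , (x≤𝟏 (y ∨ H) , y∨H≢𝟏)))
    where
      H≢y∨H : H ≢ y ∨ H
      H≢y∨H H≡y∨H = y≰H (subst (y ≤_) (sym H≡y∨H) (x≤x∨y y H))

  ∧H≡𝟎⇒≰H-below-≡ : ∀ {A y} → A ∧L H ≡ 𝟎 → y ≤ A → ¬ y ≤ H → y ≡ A
  ∧H≡𝟎⇒≰H-below-≡ {A} {y} A∧H≡𝟎 y≤A y≰H = begin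
    y                ≡⟨ sym (∨-identityʳ y) ⟩
    y ∨ 𝟎            ≡⟨ cong (y ∨_) (trans (sym A∧H≡𝟎) (∧-comm A H)) ⟩
    y ∨ (H ∧L A)     ≡⟨ modular y H A y≤A ⟩
    (y ∨ H) ∧L A     ≡⟨ cong (_∧L A) (≰H⇒∨H≡𝟏 y≰H) ⟩
    𝟏 ∧L A           ≡⟨ y≤x⇒x∧y≈y (x≤𝟏 A) ⟩
    A                ∎
    where open ≡-Reasoning

  ∧H≡𝟎⇒atom : ∀ {A} → ¬ A ≤ H → A ∧L H ≡ 𝟎 → IsAtom A
  ∧H≡𝟎⇒atom {A} A≰H A∧H≡𝟎 = (𝟎≤x A , λ 𝟎≡A → A≰H (subst (_≤ H) 𝟎≡A (𝟎≤x H))) ,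
    λ { (y , (_ , 𝟎≢y) , (y≤A , y≢A)) → y≢A (∧H≡𝟎⇒≰H-below-≡ A∧H≡𝟎 y≤A (y≰H 𝟎≢y y≤A)) }
    where
      y≰H : ∀ {y} → 𝟎 ≢ y → y ≤ A → ¬ y ≤ H
      y≰H 𝟎≢y y≤A y≤H = 𝟎≢y (≤-antisym (𝟎≤x _) (subst (_ ≤_) A∧H≡𝟎 (∧-greatest y≤A y≤H)))

  atom⇒∧H≡𝟎 : ∀ {A} → ¬ A ≤ H → IsAtom A → A ∧L H ≡ 𝟎
  atom⇒∧H≡𝟎 {A} A≰H (_ , nothing-between) with 𝟎 ≟ (A ∧L H)
  ... | yes 𝟎≡A∧H = sym 𝟎≡A∧H
  ... | no  𝟎≢A∧H = ⊥-elim (nothing-between (A ∧L H , (𝟎≤x _ , 𝟎≢A∧H) , (x∧y≤x A H , A∧H≢A)))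
    where
      A∧H≢A : A ∧L H ≢ A
      A∧H≢A A∧H≡A = A≰H (subst (_≤ H) A∧H≡A (x∧y≤y A H))

  𝟎≟∧H≡atom≰H : ∀ {A} → ¬ A ≤ H → does (𝟎 ≟ (A ∧L H)) ≡ atom≰H A
  𝟎≟∧H≡atom≰H {A} A≰H with 𝟎 ≟ (A ∧L H)
  ... | yes 𝟎≡A∧H = sym (atom≰H-intro (∧H≡𝟎⇒atom A≰H (sym 𝟎≡A∧H)) A≰H)
  ... | no  𝟎≢A∧H = sym (¬-not λ e → 𝟎≢A∧H (sym (atom⇒∧H≡𝟎 A≰H (proj₁ (atom≰H-elim e)))))

  ∑-μ-𝟎-≰H : ∀ {A} → ¬ A ≤ H →
    ∑ᴸ (λ z → [ does (z ≤? A) ∧ not (does (z ≤? H)) ]· μ 𝟎 z) ≡ - ([ atom≰H A ]· + 1)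
  ∑-μ-𝟎-≰H {A} A≰H = begin
    ∑ᴸ outside-H
      ≡⟨ cancel (∑ᴸ outside-H) (∑ᴸ below-A∧H) ⟩
    (∑ᴸ outside-H + ∑ᴸ below-A∧H) + - ∑ᴸ below-A∧H
      ≡⟨ cong (λ s → s + - ∑ᴸ below-A∧H) (trans (sym (∑-distrib-+ elems _ _)) (sym (∑-cong elems split))) ⟩
    ∑ᴸ below-A + - ∑ᴸ below-A∧H
      ≡⟨ cong₂ (λ s t → s + - t) (∑-μ-interval 𝟎 A) (∑-μ-interval 𝟎 (A ∧L H)) ⟩
    [ does (𝟎 ≟ A) ]· + 1 + - ([ does (𝟎 ≟ (A ∧L H)) ]· + 1)
      ≡⟨ cong₂ (λ s b → s + - ([ b ]· + 1)) ([false]· (dec-false (𝟎 ≟ A) 𝟎≢A)) (𝟎≟∧H≡atom≰H A≰H) ⟩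
    + 0 + - ([ atom≰H A ]· + 1)
      ≡⟨ ℤP.+-identityˡ _ ⟩
    - ([ atom≰H A ]· + 1) ∎
    where
      open ≡-Reasoning
      cancel : ∀ a b → a ≡ (a + b) + - b
      cancel = solve-∀
      𝟎≢A : 𝟎 ≢ A
      𝟎≢A 𝟎≡A = A≰H (subst (_≤ H) 𝟎≡A (𝟎≤x H))
      below-A outside-H below-A∧H : Carrier → ℤ
      below-A   z = [ does (𝟎 ≤? z) ∧ does (z ≤? A) ]· μ 𝟎 z
      outside-H z = [ does (z ≤? A) ∧ not (does (z ≤? H)) ]· μ 𝟎 z
      below-A∧H z = [ does (𝟎 ≤? z) ∧ does (z ≤? (A ∧L H)) ]· μ 𝟎 z
      split : ∀ z → below-A z ≡ outside-H z + below-A∧H z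
      split z with 𝟎 ≤? z | z ≤? A | z ≤? H | z ≤? (A ∧L H)
      ... | no  𝟎≰z | _       | _       | _       = ⊥-elim (𝟎≰z (𝟎≤x z))
      ... | yes _   | no  _   | _       | no  _   = refl
      ... | yes _   | no  z≰A | _       | yes z≤∧ = ⊥-elim (z≰A (≤-trans z≤∧ (x∧y≤x A H)))
      ... | yes _   | yes _   | yes _   | yes _   = sym (ℤP.+-identityˡ _)
      ... | yes _   | yes z≤A | yes z≤H | no  z≰∧ = ⊥-elim (z≰∧ (∧-greatest z≤A z≤H))
      ... | yes _   | yes _   | no  z≰H | yes z≤∧ = ⊥-elim (z≰H (≤-trans z≤∧ (x∧y≤y A H)))
      ... | yes _   | yes _   | no  _   | no  _   = sym (ℤP.+-identityʳ _)

  ∑-μ-atoms-≰H : ∀ {A} → ¬ A ≤ H →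
    ∑ᴸ (λ z → [ does (z ≤? A) ∧ not (does (z ≤? H)) ]· μ-atoms z) ≡ [ atom≰H A ]· + 1
  ∑-μ-atoms-≰H {A} A≰H = begin
    ∑ᴸ (λ z → [ outside-H z ]· ∑ᴸ (λ b → F z b))
      ≡⟨ ∑-cong elems (λ z → []·-∑ (outside-H z) elems (F z)) ⟩
    ∑ᴸ (λ z → ∑ᴸ (λ b → [ outside-H z ]· F z b))
      ≡⟨ ∑-comm elems elems _ ⟩
    ∑ᴸ (λ b → ∑ᴸ (λ z → [ outside-H z ]· F z b))
      ≡⟨ ∑-cong elems (λ b → trans (∑-cong elems (reorder b)) (sym ([]·-∑ (atom≰H b) elems _))) ⟩
    ∑ᴸ (λ b → [ atom≰H b ]· ∑ᴸ (λ z → [ does (b ≤? z) ∧ does (z ≤? A) ]· μ b z))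
      ≡⟨ ∑-cong elems (λ b → cong ([ atom≰H b ]·_) (∑-μ-interval b A)) ⟩
    ∑ᴸ (λ b → [ atom≰H b ]· [ does (b ≟ A) ]· + 1)
      ≡⟨ ∑ᴸ-single A _ (λ b b≢A → []·-zero (atom≰H b) (λ _ → [false]· (dec-false (b ≟ A) b≢A))) ⟩
    [ atom≰H A ]· [ does (A ≟ A) ]· + 1
      ≡⟨ cong ([ atom≰H A ]·_) ([true]· (dec-true (A ≟ A) refl)) ⟩
    [ atom≰H A ]· + 1 ∎
    where
      open ≡-Reasoning
      outside-H : Carrier → Bool
      outside-H z = does (z ≤? A) ∧ not (does (z ≤? H))
      F : Carrier → Carrier → ℤ
      F z b = [ atom≰H b ]· [ does (b ≤? z) ]· μ b z
      -- every z above an atom b ≰ H is itself ≰ H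
      reorder : ∀ b z → [ outside-H z ]· F z b ≡ [ atom≰H b ]· [ does (b ≤? z) ∧ does (z ≤? A) ]· μ b z
      reorder b z with atom≰H b in e
      ... | false = []·-zero (outside-H z) (λ _ → refl)
      ... | true with z ≤? A | z ≤? H | b ≤? z
      ...   | yes _ | yes z≤H | yes b≤z = ⊥-elim (proj₂ (atom≰H-elim e) (≤-trans b≤z z≤H))
      ...   | yes _ | yes _   | no  _   = refl
      ...   | yes _ | no  _   | yes _   = refl
      ...   | yes _ | no  _   | no  _   = refl
      ...   | no  _ | _       | yes _   = refl
      ...   | no  _ | _       | no  _   = refl

  μ-𝟎-≰H : ∀ {A} → ¬ A ≤ H → μ 𝟎 A ≡ - μ-atoms A
  μ-𝟎-≰H {A} A≰H = inverseˡ-unique (μ 𝟎 A) (μ-atoms A) (WF.All.wfRec <-wellFounded 0ℓ Vanishes step A A≰H)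
    where
      g : Carrier → ℤ
      g z = μ 𝟎 z + μ-atoms z
      Vanishes : Carrier → Set
      Vanishes A = ¬ A ≤ H → g A ≡ + 0
      step : ∀ A → (∀ {z} → z < A → Vanishes z) → Vanishes A
      step A ih A≰H = begin
        g A
          ≡⟨ sym at-A ⟩
        [ outside-H A ]· g A
          ≡⟨ sym (∑ᴸ-single A _ off) ⟩
        ∑ᴸ (λ z → [ outside-H z ]· g z)
          ≡⟨ ∑-cong elems (λ z → []·-distrib-+ (outside-H z) (μ 𝟎 z) (μ-atoms z)) ⟩
        ∑ᴸ (λ z → [ outside-H z ]· μ 𝟎 z + [ outside-H z ]· μ-atoms z)
          ≡⟨ ∑-distrib-+ elems _ _ ⟩
        ∑ᴸ (λ z → [ outside-H z ]· μ 𝟎 z) + ∑ᴸ (λ z → [ outside-H z ]· μ-atoms z)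
          ≡⟨ cong₂ _+_ (∑-μ-𝟎-≰H A≰H) (∑-μ-atoms-≰H A≰H) ⟩
        - ([ atom≰H A ]· + 1) + [ atom≰H A ]· + 1
          ≡⟨ ℤP.+-inverseˡ ([ atom≰H A ]· + 1) ⟩
        + 0 ∎
        where
          open ≡-Reasoning
          outside-H : Carrier → Bool
          outside-H z = does (z ≤? A) ∧ not (does (z ≤? H))
          off : ∀ z → z ≢ A → [ outside-H z ]· g z ≡ + 0
          off z z≢A with z ≤? A | z ≤? H
          ... | yes z≤A | no  z≰H = ih (z≤A , z≢A) z≰H
          ... | yes _   | yes _   = refl
          ... | no  _   | _       = refl
          at-A : [ outside-H A ]· g A ≡ g A
          at-A with A ≤? A | A ≤? H
          ... | yes _   | no  _   = refl
          ... | yes _   | yes A≤H = ⊥-elim (A≰H A≤H)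
          ... | no  A≰A | _       = ⊥-elim (A≰A ≤-refl)

module WeightedLatticeProperties (W : WeightedLattice) where

  open WeightedLattice W
  open FMCLatticeProperties L

  χ-coeff : ∀ X Y k →
    χ[ X , Y ] k ≡ ∑ᴸ (λ A → ([ does (X ≤? A) ∧ does (A ≤? Y) ]· μ X A) * zpow (f Y ∸ f A) k)
  χ-coeff X Y k = trans (sumₚ-apply _ elems k) (∑-cong elems term)
    where
      term : ∀ A → (if does (X ≤? A) ∧ does (A ≤? Y) then μ X A ·ₚ zpow ((f Y ∸ f X) ∸ (f A ∸ f X)) else 0ₚ) k
                 ≡ ([ does (X ≤? A) ∧ does (A ≤? Y) ]· μ X A) * zpow (f Y ∸ f A) k
      term A with X ≤? A | A ≤? Y
      ... | yes X≤A | yes _ = cong (λ e → μ X A * zpow e k) ([m∸o]∸[n∸o]≡m∸n (f Y) (f A) (f X) (f-mon X≤A))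
      ... | yes _   | no  _ = refl
      ... | no  _   | _     = refl

module CoatomPolynomials (W : WeightedLattice) (H : WeightedLattice.Carrier W)
                         (H⋖𝟏 : WeightedLattice.IsCoatom W H) where

  open WeightedLattice W
  open FMCLatticeProperties L
  open CoatomProperties L H H⋖𝟏
  open WeightedLatticeProperties W

  χ/H+1≡zpow : ∀ j → ((χ/ H) +ₚ 1ₚ) j ≡ zpow (f 𝟏 ∸ f H) j
  χ/H+1≡zpow j = begin
    χ[ H , 𝟏 ] j + zpow 0 j
      ≡⟨ cong (λ s → s + zpow 0 j) (trans (χ-coeff H 𝟏 j)
           (trans (∑-cong elems (λ A → []·-distribʳ-* _ (μ H A) (zpow (f 𝟏 ∸ f A) j)))
                  (∑-⋖-interval H⋖𝟏 (λ A → μ H A * zpow (f 𝟏 ∸ f A) j)))) ⟩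
    (μ H H * zpow (f 𝟏 ∸ f H) j + μ H 𝟏 * zpow (f 𝟏 ∸ f 𝟏) j) + zpow 0 j
      ≡⟨ cong₂ (λ a b → (a * zpow (f 𝟏 ∸ f H) j + b) + zpow 0 j)
           (μ-refl H) (cong₂ (λ c e → c * zpow e j) (μ-⋖ H⋖𝟏) (ℕP.n∸n≡0 (f 𝟏))) ⟩
    (+ 1 * zpow (f 𝟏 ∸ f H) j + - + 1 * zpow 0 j) + zpow 0 j
      ≡⟨ telescope (zpow (f 𝟏 ∸ f H) j) (zpow 0 j) ⟩
    zpow (f 𝟏 ∸ f H) j ∎
    where
      open ≡-Reasoning
      telescope : ∀ a b → (+ 1 * a + - + 1 * b) + b ≡ a
      telescope = solve-∀

  χ|H*zpow : ∀ k → ((χ| H) *ₚ zpow (f 𝟏 ∸ f H)) k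
                   ≡ ∑ᴸ (λ A → ([ does (A ≤? H) ]· μ 𝟎 A) * zpow (f 𝟏 ∸ f A) k)
  χ|H*zpow k = trans (*ₚ-zpow-shift (χ| H) (f 𝟏 ∸ f H) elems
                       (λ A → [ does (𝟎 ≤? A) ∧ does (A ≤? H) ]· μ 𝟎 A) (λ A → f H ∸ f A) (χ-coeff 𝟎 H) k)
                     (∑-cong elems term)
    where
      term : ∀ A → ([ does (𝟎 ≤? A) ∧ does (A ≤? H) ]· μ 𝟎 A) * zpow ((f 𝟏 ∸ f H) ℕ.+ (f H ∸ f A)) k
                 ≡ ([ does (A ≤? H) ]· μ 𝟎 A) * zpow (f 𝟏 ∸ f A) k
      term A with 𝟎 ≤? A | A ≤? H
      ... | no  𝟎≰A | _       = ⊥-elim (𝟎≰A (𝟎≤x A))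
      ... | yes _   | yes A≤H = cong (λ e → μ 𝟎 A * zpow e k) ([m∸n]+[n∸o]≡m∸o (f-mon A≤H) (f-mon (x≤𝟏 H)))
      ... | yes _   | no  _   = refl

  atomSumNotBelow-coeff : ∀ k → atomSumNotBelow H k ≡ ∑ᴸ (λ A → μ-atoms A * zpow (f 𝟏 ∸ f A) k)
  atomSumNotBelow-coeff k = begin
    atomSumNotBelow H k
      ≡⟨ sumₚ-apply (λ b → if atom≰H b then χ/ b else 0ₚ) elems k ⟩
    ∑ᴸ (λ b → (if atom≰H b then χ/ b else 0ₚ) k)
      ≡⟨ ∑-cong elems (λ b → trans (ifₚ-apply (atom≰H b) (χ/ b) k) (cong ([ atom≰H b ]·_) (χ-coeff b 𝟏 k))) ⟩
    ∑ᴸ (λ b → [ atom≰H b ]· ∑ᴸ (T b))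
      ≡⟨ ∑-cong elems (λ b → []·-∑ (atom≰H b) elems (T b)) ⟩
    ∑ᴸ (λ b → ∑ᴸ (λ A → [ atom≰H b ]· T b A))
      ≡⟨ ∑-comm elems elems _ ⟩
    ∑ᴸ (λ A → ∑ᴸ (λ b → [ atom≰H b ]· T b A))
      ≡⟨ ∑-cong elems (λ A → trans (∑-cong elems (term A)) (∑-distribʳ-* elems _ _)) ⟩
    ∑ᴸ (λ A → μ-atoms A * zpow (f 𝟏 ∸ f A) k) ∎
    where
      open ≡-Reasoning
      T : Carrier → Carrier → ℤ
      T b A = ([ does (b ≤? A) ∧ does (A ≤? 𝟏) ]· μ b A) * zpow (f 𝟏 ∸ f A) k
      term : ∀ A b → [ atom≰H b ]· T b A ≡ ([ atom≰H b ]· [ does (b ≤? A) ]· μ b A) * zpow (f 𝟏 ∸ f A) k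
      term A b = trans ([]·-cong (atom≰H b) (λ _ → below-𝟏)) (sym ([]·-distribʳ-* (atom≰H b) _ _))
        where
          below-𝟏 : T b A ≡ ([ does (b ≤? A) ]· μ b A) * zpow (f 𝟏 ∸ f A) k
          below-𝟏 with b ≤? A | A ≤? 𝟏
          ... | _     | no  A≰𝟏 = ⊥-elim (A≰𝟏 (x≤𝟏 A))
          ... | yes _ | yes _   = refl
          ... | no  _ | yes _   = refl

  coeff-split : ∀ A k →
    ([ does (𝟎 ≤? A) ∧ does (A ≤? 𝟏) ]· μ 𝟎 A) * zpow (f 𝟏 ∸ f A) k
      ≡ ([ does (A ≤? H) ]· μ 𝟎 A) * zpow (f 𝟏 ∸ f A) k + - (μ-atoms A * zpow (f 𝟏 ∸ f A) k)
  coeff-split A k with 𝟎 ≤? A | A ≤? 𝟏 | A ≤? H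
  ... | no  𝟎≰A | _       | _       = ⊥-elim (𝟎≰A (𝟎≤x A))
  ... | yes _   | no  A≰𝟏 | _       = ⊥-elim (A≰𝟏 (x≤𝟏 A))
  ... | yes _   | yes _   | yes A≤H =
    sym (trans (cong (λ t → μ 𝟎 A * zpow (f 𝟏 ∸ f A) k + - (t * zpow (f 𝟏 ∸ f A) k)) (μ-atoms-≤H A≤H))
               (ℤP.+-identityʳ _))
  ... | yes _   | yes _   | no  A≰H =
    trans (cong (_* zpow (f 𝟏 ∸ f A) k) (μ-𝟎-≰H A≰H))
          (trans (sym (ℤP.neg-distribˡ-* (μ-atoms A) (zpow (f 𝟏 ∸ f A) k)))
                 (sym (ℤP.+-identityˡ (- (μ-atoms A * zpow (f 𝟏 ∸ f A) k)))))

theorem3p2 : (W : WeightedLattice) (H : WeightedLattice.Carrier W) →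
    WeightedLattice.IsCoatom W H →
    let open WeightedLattice W in
    ∀ k → χ k ≡ (((χ| H) *ₚ ((χ/ H) +ₚ 1ₚ)) -ₚ atomSumNotBelow H) k
theorem3p2 W H H⋖𝟏 k = begin
  χ k
    ≡⟨ χ-coeff 𝟎 𝟏 k ⟩
  ∑ᴸ (λ A → ([ does (𝟎 ≤? A) ∧ does (A ≤? 𝟏) ]· μ 𝟎 A) * Z A)
    ≡⟨ ∑-cong elems (λ A → coeff-split A k) ⟩
  ∑ᴸ (λ A → ([ does (A ≤? H) ]· μ 𝟎 A) * Z A + - (μ-atoms A * Z A))
    ≡⟨ ∑-distrib-+ elems _ _ ⟩
  ∑ᴸ (λ A → ([ does (A ≤? H) ]· μ 𝟎 A) * Z A) + ∑ᴸ (λ A → - (μ-atoms A * Z A))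
    ≡⟨ cong₂ _+_ (sym (χ|H*zpow k)) (trans (∑-neg elems (λ A → μ-atoms A * Z A)) (cong -_ (sym (atomSumNotBelow-coeff k)))) ⟩
  ((χ| H) *ₚ zpow (f 𝟏 ∸ f H)) k + - atomSumNotBelow H k
    ≡⟨ cong (λ s → s + - atomSumNotBelow H k) (sym (*ₚ-congʳ (χ| H) χ/H+1≡zpow k)) ⟩
  ((χ| H) *ₚ ((χ/ H) +ₚ 1ₚ)) k + - atomSumNotBelow H k ∎
  where
    open WeightedLattice W
    open FMCLatticeProperties L
    open CoatomProperties L H H⋖𝟏
    open WeightedLatticeProperties W
    open CoatomPolynomials W H H⋖𝟏
    open ≡-Reasoning
    Z : Carrier → ℤ
    Z A = zpow (f 𝟏 ∸ f A) k
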